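{- Let $G=(V,E)$ be an undirected graph and $\epsilon>0$ such that for every $S\subseteq V$ with $|V|/10\le|S|\le9|V|/10$ we have $|E(S,V\setminus S)|\ge\Omega(\sqrt{\epsilon}|E|)$. Let $r\ge|V|\cdot|E|$ be an integer and let $G'=(V',E')$ be the graph with $V'=(V\times[r])\cup E$ (copies $v^1,\dots,v^r$ of each $v\in V$, one node per edge of $G$) and $E'=\{\{e,v^i\}:e\in E,v\in e,i\in[r]\}$. Then $\mathrm{tw}(G')\ge\Omega(\sqrt{\epsilon}|E|)$.
   Context: A tree decomposition of a graph $H=(U,F)$ is a tree $T$ with sets $U_t\subseteq U$ ($t\in T$) such that $\bigcup_tU_t=U$, each edge has both endpoints in some $U_t$, and for each $u\in U$ the set $\{t:u\in U_t\}$ induces a subtree of $T$; its width is $\max_t|U_t|-1$ and $\mathrm{tw}(H)$ is the minimum width. The $\Omega(\cdot)$ in the conclusion hides a positive constant depending only on the constant hidden in the hypothesis. -}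

module Defs where

open import Data.Bool using (Bool; true; false; T; _∧_; _xor_)
open import Data.Nat using (ℕ; zero; suc; _⊔_; _∸_; _≤_)
open import Data.Fin using (Fin) renaming (_<_ to _<ᶠ_)
open import Data.Fin.Base using () renaming (_≤_ to _≤ᶠ_)
open import Data.Fin.Subset using (Subset)
open import Data.Vec using (lookup)
open import Data.List using (List; []; _∷_; length; filterᵇ; cartesianProduct; allFin; map; foldr; _++_; take)
open import Data.List.Membership.Propositional using (_∈_)
open import Data.List.Relation.Unary.Unique.Propositional using (Unique)
open import Data.Product using (Σ; ∃; _×_; _,_; proj₁; proj₂)
open import Data.Sum using (_⊎_; inj₁; inj₂)
open import Data.Unit using (⊤)
open import Data.Empty using (⊥)
open import Data.Integer using (+_)
open import Data.Rational using (ℚ; _/_)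
open import Relation.Binary.PropositionalEquality using (_≡_)

record Graph (n : ℕ) : Set where
  field
    adj    : Fin n → Fin n → Bool
    sym    : ∀ i j → adj i j ≡ adj j i
    irrefl : ∀ i → adj i i ≡ false
open Graph public

_<ᵇᶠ_ : ∀ {n} → Fin n → Fin n → Bool
i <ᵇᶠ j = Data.Nat._<ᵇ_ (Data.Fin.toℕ i) (Data.Fin.toℕ j)

-- each undirected edge {i,j} is represented once, as the pair (i , j) with i < j
isEdgeᵇ : ∀ {n} → Graph n → Fin n × Fin n → Bool
isEdgeᵇ G (i , j) = (i <ᵇᶠ j) ∧ adj G i j

allPairs : ∀ n → List (Fin n × Fin n)
allPairs n = cartesianProduct (allFin n) (allFin n)

edgeList : ∀ {n} → Graph n → List (Fin n × Fin n)
edgeList {n} G = filterᵇ (isEdgeᵇ G) (allPairs n)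

numEdges : ∀ {n} → Graph n → ℕ
numEdges G = length (edgeList G)

Edge : ∀ {n} → Graph n → Set
Edge {n} G = Σ (Fin n × Fin n) λ p → T (isEdgeᵇ G p)

cutSize : ∀ {n} → Graph n → Subset n → ℕ
cutSize {n} G S =
  length (filterᵇ (λ p → isEdgeᵇ G p ∧ (lookup S (proj₁ p) xor lookup S (proj₂ p)))
                  (allPairs n))

_∈ₑ_ : ∀ {n} {G : Graph n} → Fin n → Edge G → Set
v ∈ₑ ((a , b) , _) = (v ≡ a) ⊎ (v ≡ b)

V′ : ∀ {n} → Graph n → ℕ → Set
V′ {n} G r = (Fin n × Fin r) ⊎ Edge G

data E′ {n} (G : Graph n) (r : ℕ) : V′ G r → V′ G r → Set where
  e-v : (e : Edge G) (v : Fin n) (i : Fin r) → _∈ₑ_ {G = G} v e → E′ G r (inj₂ e) (inj₁ (v , i))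
  v-e : (e : Edge G) (v : Fin n) (i : Fin r) → _∈ₑ_ {G = G} v e → E′ G r (inj₁ (v , i)) (inj₂ e)

data Walk {k : ℕ} (A : Fin k → Fin k → Bool) (P : Fin k → Set) : Fin k → Fin k → Set where
  stop : ∀ {s} → P s → Walk A P s s
  step : ∀ {s t u} → P s → T (A s t) → Walk A P t u → Walk A P s u

ConsecAdj : ∀ {k} → (Fin k → Fin k → Bool) → List (Fin k) → Set
ConsecAdj A (x ∷ y ∷ rest) = T (A x y) × ConsecAdj A (y ∷ rest)
ConsecAdj A _              = ⊤

HasCycle : ∀ {k} → (Fin k → Fin k → Bool) → Set
HasCycle {k} A = Σ (List (Fin k)) λ vs →
  (3 ≤ length vs) × Unique vs × ConsecAdj A (vs ++ take 1 vs)

record Tree (k : ℕ) : Set where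
  field
    tadj      : Fin k → Fin k → Bool
    tsym      : ∀ s t → tadj s t ≡ tadj t s
    tirrefl   : ∀ s → tadj s s ≡ false
    connected : ∀ s t → Walk tadj (λ _ → ⊤) s t
    acyclic   : HasCycle tadj → ⊥
open Tree public

record TreeDecomposition (U : Set) (F : U → U → Set) : Set where
  field
    k        : ℕ
    tree     : Tree (suc k)
    bag      : Fin (suc k) → List U
    bagUniq  : ∀ t → Unique (bag t)
    cover    : ∀ u → ∃ λ t → u ∈ bag t
    edgeCov  : ∀ u v → F u v → ∃ λ t → (u ∈ bag t) × (v ∈ bag t)
    -- {t : u ∈ U_t} induces a connected subgraph (subtree) of T
    subtree  : ∀ u s t → u ∈ bag s → u ∈ bag t →
               Walk (tadj tree) (λ x → u ∈ bag x) s t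
open TreeDecomposition public

width : ∀ {U F} → TreeDecomposition U F → ℕ
width D = foldr _⊔_ 0 (map (λ t → length (bag D t)) (allFin (suc (k D)))) ∸ 1

ℕ→ℚ : ℕ → ℚ
ℕ→ℚ n = (+ n) / 1

sqℚ : ℕ → ℚ
sqℚ n = ℕ→ℚ n Data.Rational.* ℕ→ℚ n

module Submission where

-- Every balanced cut has at most |E| edges, and r ≥ |V||E| ≥ 2|E| copies, so if some bag has at least r/10
-- nodes, then tw + 1 ≥ |E|/5 already. Otherwise take a bag U_t such that each component of T - t holds at
-- most half of the n r copies. Every vertex has a copy outside U_t, and an edge node outside U_t lies in the
-- same component of T - t as the outside copies of its endpoints. Group the vertices by the component their
-- outside edges lead to: all r copies of a group lie in U_t or in that component, so it has at most n/2
-- vertices. A suitable union of groups is a balanced S whose crossing edges all lie in U_t, whence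
-- c √ε |E| ≤ |E(S, V ∖ S)| ≤ |U_t| ≤ tw + 1, and c′ = c/10 works.

open import Defs
open import Data.Bool using (Bool; true; false; T; _∧_; _∨_; not; _xor_)
open import Data.Bool.Properties using (T?; T-irrelevant; T-∧; xor-same; ∧-zeroʳ)
open import Data.Unit using (⊤; tt)
open import Data.Empty using (⊥; ⊥-elim)
open import Data.Nat using (ℕ; zero; suc; _+_; _*_; _≤_; _<_; z≤n; s≤s; s≤s⁻¹; _<ᵇ_; _≡ᵇ_; _≤?_; _<?_; _⊔_; >-nonZero)
open import Data.Nat.Properties hiding (_≟_)
open import Data.Fin as Fin using (Fin; toℕ; fromℕ<; _≟_)
open import Data.Fin.Properties using (any?; toℕ<n; toℕ-injective; toℕ-fromℕ<)
open import Data.Fin.Subset using (Subset; ∣_∣)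
import Data.Vec as Vec
open import Data.Vec.Properties using (lookup∘tabulate)
open import Data.Maybe using (Maybe; just; nothing)
open import Data.List using (List; []; _∷_; length; filterᵇ; _++_; map; mapMaybe; cartesianProduct; allFin; foldr)
open import Data.List.Properties using (length-++; length-map; length-tabulate; length-mapMaybe)
open import Data.List.Membership.Propositional using (_∈_)
open import Data.List.Membership.Propositional.Properties
  using (∈-∃++; ∈-++⁻; ∈-++⁺ˡ; ∈-++⁺ʳ; ∈-filter⁻; ∈-allFin; ∈-map⁻)
open import Data.List.Relation.Unary.Any using (here; there)
open import Data.List.Relation.Unary.All using (All; []; _∷_)
open import Data.List.Relation.Unary.All.Properties.Core using (¬Any⇒All¬)
open import Data.List.Relation.Unary.AllPairs using ([]; _∷_)
open import Data.List.Relation.Unary.Unique.Propositional using (Unique)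
open import Data.List.Relation.Unary.Unique.Propositional.Properties
  using (filter⁺; allFin⁺; cartesianProduct⁺; map⁺)
open import Data.Sum using (_⊎_; inj₁; inj₂)
import Data.Sum.Properties as Sum
open import Data.Product using (Σ; ∃; _×_; _,_; proj₁; proj₂)
import Data.Product.Properties as Product
open import Function using (_∘_; _∘′_; id)
open import Function.Bundles using (module Equivalence)
open import Relation.Nullary using (¬_; Dec; yes; no; does; ¬?)
open import Relation.Nullary.Decidable using (⌊_⌋; toWitness; fromWitness; dec-true; dec-false; isYes≗does)
import Data.List.Membership.DecPropositional
open import Relation.Binary.Definitions using (DecidableEquality)
open import Relation.Binary.PropositionalEquality
  using (_≡_; refl; trans; cong; cong₂; subst; subst₂; module ≡-Reasoning)
  renaming (sym to ≡-sym)
open import Data.Rational using (ℚ; 0ℚ) renaming (_<_ to _<ℚ_; _≤_ to _≤ℚ_; _*_ to _*ℚ_)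
open import Data.Rational.Solver using (module +-*-Solver)
import Data.Rational as ℚ
import Data.Rational.Properties as ℚ
import Data.Integer as ℤ
import Data.Integer.Properties as ℤ
open import Data.Nat.Coprimality using (1-coprimeTo)
import Data.Nat.Coprimality as Coprime

countᵇ : ∀ {a} {A : Set a} → (A → Bool) → List A → ℕ
countᵇ p xs = length (filterᵇ p xs)

module _ {a} {A : Set a} where

  Unique-⊆⇒length-≤ : (xs ys : List A) → Unique xs → (∀ x → x ∈ xs → x ∈ ys) → length xs ≤ length ys
  Unique-⊆⇒length-≤ [] ys _ _ = z≤n
  Unique-⊆⇒length-≤ (x ∷ xs) ys (x∉xs ∷ xs!) xs⊆ys with ∈-∃++ (xs⊆ys x (here refl))
  ... | us , vs , refl = begin
      suc (length xs)             ≤⟨ s≤s (Unique-⊆⇒length-≤ xs (us ++ vs) xs! xs⊆us++vs) ⟩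
      suc (length (us ++ vs))     ≡⟨ cong suc (length-++ us) ⟩
      suc (length us + length vs) ≡⟨ ≡-sym (+-suc (length us) (length vs)) ⟩
      length us + length (x ∷ vs) ≡⟨ ≡-sym (length-++ us) ⟩
      length (us ++ x ∷ vs)       ∎
    where
    open ≤-Reasoning
    ∉-All : ∀ {zs} → All (λ z → ¬ x ≡ z) zs → ¬ x ∈ zs
    ∉-All (x≢z ∷ _) (here refl) = x≢z refl
    ∉-All (_ ∷ x≢zs) (there x∈zs) = ∉-All x≢zs x∈zs
    xs⊆us++vs : ∀ y → y ∈ xs → y ∈ us ++ vs
    xs⊆us++vs y y∈xs with ∈-++⁻ us (xs⊆ys y (there y∈xs))
    ... | inj₁ y∈us = ∈-++⁺ˡ y∈us
    ... | inj₂ (here refl) = ⊥-elim (∉-All x∉xs y∈xs)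
    ... | inj₂ (there y∈vs) = ∈-++⁺ʳ us y∈vs

  countᵇ-const-false : (xs : List A) → countᵇ (λ _ → false) xs ≡ 0
  countᵇ-const-false [] = refl
  countᵇ-const-false (_ ∷ xs) = countᵇ-const-false xs

  countᵇ-const-true : (xs : List A) → countᵇ (λ _ → true) xs ≡ length xs
  countᵇ-const-true [] = refl
  countᵇ-const-true (_ ∷ xs) = cong suc (countᵇ-const-true xs)

  countᵇ-mono : (p q : A → Bool) (xs : List A) → (∀ x → x ∈ xs → T (p x) → T (q x)) →
                countᵇ p xs ≤ countᵇ q xs
  countᵇ-mono p q [] _ = z≤n
  countᵇ-mono p q (x ∷ xs) p⇒q with p x in px | q x in qx
  ... | true  | true  = s≤s (countᵇ-mono p q xs (λ y → p⇒q y ∘ there))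
  ... | true  | false = ⊥-elim (subst T qx (p⇒q x (here refl) (subst T (≡-sym px) tt)))
  ... | false | true  = m≤n⇒m≤1+n (countᵇ-mono p q xs (λ y → p⇒q y ∘ there))
  ... | false | false = countᵇ-mono p q xs (λ y → p⇒q y ∘ there)

  countᵇ-mono-< : (p q : A → Bool) (xs : List A) → (∀ x → x ∈ xs → T (p x) → T (q x)) →
                  (z : A) → z ∈ xs → T (q z) → ¬ T (p z) → countᵇ p xs < countᵇ q xs
  countᵇ-mono-< p q (x ∷ xs) p⇒q z z∈ qz ¬pz with p x in px | q x in qx | z∈
  ... | true  | true  | here refl = ⊥-elim (¬pz (subst T (≡-sym px) tt))
  ... | true  | true  | there z∈xs = s≤s (countᵇ-mono-< p q xs (λ y → p⇒q y ∘ there) z z∈xs qz ¬pz)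
  ... | true  | false | _ = ⊥-elim (subst T qx (p⇒q x (here refl) (subst T (≡-sym px) tt)))
  ... | false | true  | _ = s≤s (countᵇ-mono p q xs (λ y → p⇒q y ∘ there))
  ... | false | false | here refl = ⊥-elim (subst T qx qz)
  ... | false | false | there z∈xs = countᵇ-mono-< p q xs (λ y → p⇒q y ∘ there) z z∈xs qz ¬pz

  countᵇ-≤-+ : (p q s : A → Bool) (xs : List A) → (∀ x → x ∈ xs → T (p x) → T (q x) ⊎ T (s x)) →
               countᵇ p xs ≤ countᵇ q xs + countᵇ s xs
  countᵇ-≤-+ p q s [] _ = z≤n
  countᵇ-≤-+ p q s (x ∷ xs) p⇒q∨s with countᵇ-≤-+ p q s xs (λ y → p⇒q∨s y ∘ there)
  ... | ih with p x | q x | s x | p⇒q∨s x (here refl)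
  ... | false | false | false | _ = ih
  ... | false | false | true  | _ = ≤-trans ih (+-monoʳ-≤ (countᵇ q xs) (n≤1+n _))
  ... | false | true  | false | _ = m≤n⇒m≤1+n ih
  ... | false | true  | true  | _ = m≤n⇒m≤1+n (≤-trans ih (+-monoʳ-≤ (countᵇ q xs) (n≤1+n _)))
  ... | true  | true  | false | _ = s≤s ih
  ... | true  | true  | true  | _ = s≤s (≤-trans ih (+-monoʳ-≤ (countᵇ q xs) (n≤1+n _)))
  ... | true  | false | true  | _ = ≤-trans (s≤s ih) (≤-reflexive (≡-sym (+-suc _ _)))
  ... | true  | false | false | q∨s with q∨s tt
  ...   | inj₁ ()
  ...   | inj₂ ()

  countᵇ-disjoint : (p q : A → Bool) (xs : List A) → (∀ x → T (p x) → T (q x) → ⊥) →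
                    countᵇ p xs + countᵇ q xs ≤ length xs
  countᵇ-disjoint p q [] _ = z≤n
  countᵇ-disjoint p q (x ∷ xs) p#q with countᵇ-disjoint p q xs p#q
  ... | ih with p x in px | q x in qx
  ... | true  | true  = ⊥-elim (p#q x (subst T (≡-sym px) tt) (subst T (≡-sym qx) tt))
  ... | true  | false = s≤s ih
  ... | false | true  = ≤-trans (≤-reflexive (+-suc _ _)) (s≤s ih)
  ... | false | false = m≤n⇒m≤1+n ih

  countᵇ>0⇒∃ : (p : A → Bool) (xs : List A) → 0 < countᵇ p xs → ∃ λ x → x ∈ xs × T (p x)
  countᵇ>0⇒∃ p (x ∷ xs) pos with p x in px
  ... | true = x , here refl , subst T (≡-sym px) tt
  ... | false with countᵇ>0⇒∃ p xs pos
  ...   | y , y∈xs , py = y , there y∈xs , py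

  ∈-filterᵇ⁻ : (p : A → Bool) (xs : List A) {x : A} → x ∈ filterᵇ p xs → x ∈ xs × T (p x)
  ∈-filterᵇ⁻ p xs = ∈-filter⁻ (T? ∘ p)

  Unique-filterᵇ : (p : A → Bool) {xs : List A} → Unique xs → Unique (filterᵇ p xs)
  Unique-filterᵇ p = filter⁺ (T? ∘ p)

  countᵇ≤1 : (p : A → Bool) (xs : List A) → Unique xs → (∀ x y → T (p x) → T (p y) → x ≡ y) → countᵇ p xs ≤ 1
  countᵇ≤1 p xs xs! p-unique with filterᵇ p xs in eq
  ... | [] = z≤n
  ... | x ∷ ys = Unique-⊆⇒length-≤ (x ∷ ys) (x ∷ []) (subst Unique eq (Unique-filterᵇ p xs!)) ⊆[x]
    where
    satisfies : ∀ {y} → y ∈ x ∷ ys → T (p y)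
    satisfies y∈ = proj₂ (∈-filterᵇ⁻ p xs (subst (_ ∈_) (≡-sym eq) y∈))
    ⊆[x] : ∀ y → y ∈ x ∷ ys → y ∈ x ∷ []
    ⊆[x] y y∈ = here (p-unique y x (satisfies y∈) (satisfies (here refl)))

countᵇ-++ : ∀ {a} {A : Set a} (p : A → Bool) (xs ys : List A) → countᵇ p (xs ++ ys) ≡ countᵇ p xs + countᵇ p ys
countᵇ-++ p [] ys = refl
countᵇ-++ p (x ∷ xs) ys with p x
... | true = cong suc (countᵇ-++ p xs ys)
... | false = countᵇ-++ p xs ys

countᵇ-map : ∀ {a b} {A : Set a} {B : Set b} (p : B → Bool) (f : A → B) (xs : List A) →
             countᵇ p (map f xs) ≡ countᵇ (p ∘ f) xs
countᵇ-map p f [] = refl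
countᵇ-map p f (x ∷ xs) with p (f x)
... | true = cong suc (countᵇ-map p f xs)
... | false = countᵇ-map p f xs

countᵇ-const : ∀ {a b} {A : Set a} {B : Set b} (p : A → Bool) (x : A) (ys : List B) →
               countᵇ (λ _ → p x) ys ≡ countᵇ p (x ∷ []) * length ys
countᵇ-const p x ys with p x
... | true = trans (countᵇ-const-true ys) (≡-sym (+-identityʳ (length ys)))
... | false = countᵇ-const-false ys

countᵇ-cartesianProduct : ∀ {a b} {A : Set a} {B : Set b} (p : A → Bool) (xs : List A) (ys : List B) →
                          countᵇ (p ∘ proj₁) (cartesianProduct xs ys) ≡ countᵇ p xs * length ys
countᵇ-cartesianProduct p [] ys = refl
countᵇ-cartesianProduct p (x ∷ xs) ys = begin
    countᵇ (p ∘ proj₁) (map (x ,_) ys ++ cartesianProduct xs ys)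
  ≡⟨ countᵇ-++ (p ∘ proj₁) (map (x ,_) ys) _ ⟩
    countᵇ (p ∘ proj₁) (map (x ,_) ys) + countᵇ (p ∘ proj₁) (cartesianProduct xs ys)
  ≡⟨ cong₂ _+_ (trans (countᵇ-map (p ∘ proj₁) (x ,_) ys) (countᵇ-const p x ys)) (countᵇ-cartesianProduct p xs ys) ⟩
    countᵇ p (x ∷ []) * length ys + countᵇ p xs * length ys
  ≡⟨ ≡-sym (*-distribʳ-+ (length ys) (countᵇ p (x ∷ [])) (countᵇ p xs)) ⟩
    (countᵇ p (x ∷ []) + countᵇ p xs) * length ys
  ≡⟨ cong (_* length ys) (≡-sym (countᵇ-++ p (x ∷ []) xs)) ⟩
    countᵇ p (x ∷ xs) * length ys ∎
  where open ≡-Reasoning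

∣tabulate∣≡countᵇ : ∀ {a} {A : Set a} n (f : A → Bool) (g : Fin n → A) →
                    ∣ Vec.tabulate (f ∘ g) ∣ ≡ countᵇ f (Data.List.tabulate g)
∣tabulate∣≡countᵇ zero f g = refl
∣tabulate∣≡countᵇ (suc n) f g with f (g Fin.zero)
... | true = cong suc (∣tabulate∣≡countᵇ n f (g ∘ Fin.suc))
... | false = ∣tabulate∣≡countᵇ n f (g ∘ Fin.suc)

Balanced : ∀ {n} → Subset n → Set
Balanced {n} S = n ≤ 10 * ∣ S ∣ × 10 * ∣ S ∣ ≤ 9 * n

balanced-crossing : ∀ n (F : ℕ → ℕ) → 1 ≤ n → F 0 ≡ 0 →
                    (∀ j → 10 * F j < n → 10 * F (suc j) ≤ 9 * n) →
                    ∀ K → n ≤ 10 * F K → ∃ λ j → n ≤ 10 * F j × 10 * F j ≤ 9 * n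
balanced-crossing n F n≥1 F0≡0 _ zero n≤F0 = ⊥-elim (<⇒≱ n≥1 (subst (λ m → n ≤ 10 * m) F0≡0 n≤F0))
balanced-crossing n F n≥1 F0≡0 jump (suc K) n≤FK+1 with n ≤? 10 * F K
... | yes n≤FK = balanced-crossing n F n≥1 F0≡0 jump K n≤FK
... | no n≰FK = suc K , n≤FK+1 , jump K (≰⇒> n≰FK)

keyBelow : ∀ {n} → (Fin n → ℕ) → ℕ → Subset n
keyBelow key j = Vec.tabulate (λ v → key v <ᵇ j)

keyClassSize : ∀ {n} → (Fin n → ℕ) → ℕ → ℕ
keyClassSize {n} key j = countᵇ (λ v → key v ≡ᵇ j) (allFin n)

-- Raising the threshold by one adds a single key class, of size at most n/2: a set below n/10 cannot jump past 9n/10.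
balanced-keyBelow : ∀ {n} (key : Fin n → ℕ) bound → 1 ≤ n → (∀ v → key v < bound) →
                    (∀ j → 10 * keyClassSize key j ≤ 5 * n) → ∃ λ j → Balanced (keyBelow key j)
balanced-keyBelow {n} key bound n≥1 key<bound classes≤n/2 =
  balanced-crossing n (λ j → ∣ keyBelow key j ∣) n≥1 none jump bound all
  where
  size≡ : ∀ j → ∣ keyBelow key j ∣ ≡ countᵇ (λ v → key v <ᵇ j) (allFin n)
  size≡ j = ∣tabulate∣≡countᵇ n (λ v → key v <ᵇ j) id
  none : ∣ keyBelow key 0 ∣ ≡ 0
  none = trans (size≡ 0) (countᵇ-const-false (allFin n))
  all : n ≤ 10 * ∣ keyBelow key bound ∣
  all = ≤-trans (m≤n*m n 10) (*-monoʳ-≤ 10 (begin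
      n                                            ≡⟨ ≡-sym (length-tabulate id) ⟩
      length (allFin n)                            ≡⟨ ≡-sym (countᵇ-const-true (allFin n)) ⟩
      countᵇ (λ _ → true) (allFin n)               ≤⟨ countᵇ-mono _ _ (allFin n) (λ v _ _ → <⇒<ᵇ (key<bound v)) ⟩
      countᵇ (λ v → key v <ᵇ bound) (allFin n)     ≡⟨ ≡-sym (size≡ bound) ⟩
      ∣ keyBelow key bound ∣                       ∎))
    where open ≤-Reasoning
  below-or-at : ∀ j v → v ∈ allFin n → T (key v <ᵇ suc j) → T (key v <ᵇ j) ⊎ T (key v ≡ᵇ j)
  below-or-at j v _ key<1+j with m≤n⇒m<n∨m≡n (s≤s⁻¹ (<ᵇ⇒< (key v) (suc j) key<1+j))
  ... | inj₁ key<j = inj₁ (<⇒<ᵇ key<j)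
  ... | inj₂ key≡j = inj₂ (≡⇒≡ᵇ (key v) j key≡j)
  jump : ∀ j → 10 * ∣ keyBelow key j ∣ < n → 10 * ∣ keyBelow key (suc j) ∣ ≤ 9 * n
  jump j small = begin
      10 * ∣ keyBelow key (suc j) ∣
    ≤⟨ *-monoʳ-≤ 10 (begin
         ∣ keyBelow key (suc j) ∣                   ≡⟨ size≡ (suc j) ⟩
         countᵇ (λ v → key v <ᵇ suc j) (allFin n)   ≤⟨ countᵇ-≤-+ _ _ _ (allFin n) (below-or-at j) ⟩
         countᵇ (λ v → key v <ᵇ j) (allFin n) + keyClassSize key j
                                                    ≡⟨ cong (_+ keyClassSize key j) (≡-sym (size≡ j)) ⟩
         ∣ keyBelow key j ∣ + keyClassSize key j    ∎) ⟩
      10 * (∣ keyBelow key j ∣ + keyClassSize key j)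
    ≡⟨ *-distribˡ-+ 10 ∣ keyBelow key j ∣ (keyClassSize key j) ⟩
      10 * ∣ keyBelow key j ∣ + 10 * keyClassSize key j
    ≤⟨ +-mono-≤ (<⇒≤ small) (classes≤n/2 j) ⟩
      n + 5 * n
    ≤⟨ +-monoʳ-≤ n (*-monoˡ-≤ n {5} {8} (s≤s (s≤s (s≤s (s≤s (s≤s z≤n)))))) ⟩
      9 * n ∎
    where open ≤-Reasoning

keyBelow-separates : ∀ {n} (key : Fin n → ℕ) j (u v : Fin n) →
                     T (Vec.lookup (keyBelow key j) u xor Vec.lookup (keyBelow key j) v) → ¬ key u ≡ key v
keyBelow-separates key j u v crossing key-u≡key-v = subst T xor≡false crossing
  where
  open ≡-Reasoning
  xor≡false : Vec.lookup (keyBelow key j) u xor Vec.lookup (keyBelow key j) v ≡ false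
  xor≡false = begin
    Vec.lookup (keyBelow key j) u xor Vec.lookup (keyBelow key j) v ≡⟨ cong₂ _xor_ (lookup∘tabulate _ u) (lookup∘tabulate _ v) ⟩
    (key u <ᵇ j) xor (key v <ᵇ j)                                   ≡⟨ cong (λ k → (key u <ᵇ j) xor (k <ᵇ j)) (≡-sym key-u≡key-v) ⟩
    (key u <ᵇ j) xor (key u <ᵇ j)                                   ≡⟨ xor-same (key u <ᵇ j) ⟩
    false                                                            ∎

module _ {k : ℕ} {A : Fin k → Fin k → Bool} where

  Walk-start : ∀ {P s t} → Walk A P s t → P s
  Walk-start (stop p) = p
  Walk-start (step p _ _) = p

  Walk-end : ∀ {P s t} → Walk A P s t → P t
  Walk-end (stop p) = p
  Walk-end (step _ _ w) = Walk-end w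

  Walk-map : ∀ {P Q : Fin k → Set} {s t} → (∀ x → P x → Q x) → Walk A P s t → Walk A Q s t
  Walk-map f (stop p) = stop (f _ p)
  Walk-map f (step p a w) = step (f _ p) a (Walk-map f w)

  Walk-forget : ∀ {P s t} → Walk A P s t → Walk A (λ _ → ⊤) s t
  Walk-forget = Walk-map (λ _ _ → tt)

  _++ʷ_ : ∀ {P s t u} → Walk A P s t → Walk A P t u → Walk A P s u
  stop _ ++ʷ w′ = w′
  step p a w ++ʷ w′ = step p a (w ++ʷ w′)

  vertices : ∀ {P s t} → Walk A P s t → List (Fin k)
  vertices (stop {s} _) = s ∷ []
  vertices (step {s} _ _ w) = s ∷ vertices w

  suffixFrom : ∀ {P s t} (w : Walk A P s t) z → z ∈ vertices w →
               Σ (Walk A P z t) λ w′ → Unique (vertices w) → Unique (vertices w′)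
  suffixFrom (stop p) z (here refl) = stop p , id
  suffixFrom (step p a w) z (here refl) = step p a w , id
  suffixFrom (step p a w) z (there z∈w) with suffixFrom w z z∈w
  ... | w′ , shrink = w′ , λ { (_ ∷ w!) → shrink w! }

  path : ∀ {P s t} → Walk A P s t → Σ (Walk A P s t) λ w → Unique (vertices w)
  path (stop p) = stop p , [] ∷ []
  path {s = s} (step p a w) with path w
  ... | w′ , w′! with Data.List.Membership.DecPropositional._∈?_ _≟_ s (vertices w′)
  ...   | yes s∈w′ = proj₁ (suffixFrom w′ s s∈w′) , proj₂ (suffixFrom w′ s s∈w′) w′!
  ...   | no s∉w′ = step p a w′ , ¬Any⇒All¬ (vertices w′) s∉w′ ∷ w′!

Walk-mapAdj : ∀ {k} {A B : Fin k → Fin k → Bool} {P : Fin k → Set} {s t} →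
              (∀ x y → P x → P y → T (A x y) → T (B x y)) → Walk A P s t → Walk B P s t
Walk-mapAdj f (stop p) = stop p
Walk-mapAdj f (step p a w) = step p (f _ _ p (Walk-start w) a) (Walk-mapAdj f w)

⌊≟⌋-refl : ∀ {k} (x : Fin k) → ⌊ x ≟ x ⌋ ≡ true
⌊≟⌋-refl x = trans (isYes≗does (x ≟ x)) (dec-true (x ≟ x) refl)

⌊≟⌋-≢ : ∀ {k} {x y : Fin k} → ¬ x ≡ y → ⌊ x ≟ y ⌋ ≡ false
⌊≟⌋-≢ {x = x} {y} x≢y = trans (isYes≗does (x ≟ y)) (dec-false (x ≟ y) x≢y)

module TreeBranches {k : ℕ} (Tr : Tree k) where

  private
    A : Fin k → Fin k → Bool
    A = tadj Tr

  adj-sym : ∀ {s t} → T (A s t) → T (A t s)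
  adj-sym {s} {t} = subst T (tsym Tr s t)

  adj⇒≢ : ∀ {t s} → T (A t s) → ¬ s ≡ t
  adj⇒≢ {t} a refl = subst T (tirrefl Tr t) a

  Walk-reverse : ∀ {P s t} → Walk A P s t → Walk A P t s
  Walk-reverse (stop p) = stop p
  Walk-reverse (step p a w) = Walk-reverse w ++ʷ step (Walk-start w) (adj-sym a) (stop p)

  Avoiding : Fin k → Fin k → Set
  Avoiding t x = ¬ x ≡ t

  withoutEdge : Fin k → Fin k → Fin k → Fin k → Bool
  withoutEdge s t x y = A x y ∧ not ((⌊ x ≟ s ⌋ ∧ ⌊ y ≟ t ⌋) ∨ (⌊ x ≟ t ⌋ ∧ ⌊ y ≟ s ⌋))

  withoutEdge⊆ : ∀ s t x y → T (withoutEdge s t x y) → T (A x y)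
  withoutEdge⊆ s t x y h with A x y
  ... | true = tt

  withoutEdge-removes : ∀ s t → ¬ T (withoutEdge s t s t)
  withoutEdge-removes s t h rewrite ⌊≟⌋-refl s | ⌊≟⌋-refl t with A s t
  ... | true = h
  ... | false = h

  withoutEdge-avoiding : ∀ s t x y → ¬ x ≡ t → ¬ y ≡ t → T (A x y) → T (withoutEdge s t x y)
  withoutEdge-avoiding s t x y x≢t y≢t a rewrite ⌊≟⌋-≢ y≢t | ⌊≟⌋-≢ x≢t | ∧-zeroʳ (⌊ x ≟ s ⌋) with A x y
  ... | true = tt

  withoutEdge-avoiding′ : ∀ s t x y → ¬ x ≡ s → ¬ y ≡ s → T (A x y) → T (withoutEdge s t x y)
  withoutEdge-avoiding′ s t x y x≢s y≢s a rewrite ⌊≟⌋-≢ y≢s | ⌊≟⌋-≢ x≢s | ∧-zeroʳ (⌊ x ≟ t ⌋) with A x y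
  ... | true = tt

  withoutEdge-other : ∀ s′ t s → ¬ s ≡ s′ → ¬ s ≡ t → T (A s t) → T (withoutEdge s′ t s t)
  withoutEdge-other s′ t s s≢s′ s≢t a rewrite ⌊≟⌋-≢ s≢s′ | ⌊≟⌋-≢ s≢t with A s t
  ... | true = tt

  closesCycle : ∀ {B : Fin k → Fin k → Bool} {P s t} (w : Walk B P s t) → (∀ x y → T (B x y) → T (A x y)) →
                ∀ z → T (A t z) → ConsecAdj A (vertices w ++ z ∷ [])
  closesCycle (stop _) _ z a = a , tt
  closesCycle (step _ b (stop p)) B⊆A z a = B⊆A _ _ b , a , tt
  closesCycle (step _ b (step p b′ w)) B⊆A z a = B⊆A _ _ b , closesCycle (step p b′ w) B⊆A z a

  -- A shortest bypass of the edge {s,t} has at least three vertices, and together with the edge it is a cycle.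
  no-bypass : ∀ {P s t} → T (A s t) → ¬ Walk (withoutEdge s t) P s t
  no-bypass {s = s} {t} a w with path w
  ... | stop _ , _ = subst T (tirrefl Tr s) a
  ... | step _ b (stop _) , _ = withoutEdge-removes s t b
  ... | p@(step _ _ (step _ _ w′)) , p! =
    acyclic Tr (vertices p , s≤s (s≤s (length-vertices w′)) , p! ,
                closesCycle p (withoutEdge⊆ s t) s (adj-sym a))
    where
    length-vertices : ∀ {B P x y} (v : Walk B P x y) → 1 ≤ length (vertices v)
    length-vertices (stop _) = s≤s z≤n
    length-vertices (step _ _ _) = s≤s z≤n

  branch-unique : ∀ {t s s′ x} → T (A t s) → T (A t s′) →
                  Walk A (Avoiding t) s x → Walk A (Avoiding t) s′ x → s ≡ s′
  branch-unique {t} {s} {s′} a a′ w w′ with s ≟ s′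
  ... | yes s≡s′ = s≡s′
  ... | no s≢s′ = ⊥-elim (no-bypass (adj-sym a′) (s′⇝s ++ʷ step tt s→t (stop tt)))
    where
    s′⇝s : Walk (withoutEdge s′ t) (λ _ → ⊤) s′ s
    s′⇝s = Walk-forget (Walk-mapAdj (withoutEdge-avoiding s′ t) (w′ ++ʷ Walk-reverse w))
    s→t : T (withoutEdge s′ t s t)
    s→t = withoutEdge-other s′ t s s≢s′ (Walk-start w) (adj-sym a)

  sides-disjoint : ∀ {s t y} → T (A s t) → Walk A (Avoiding t) s y → Walk A (Avoiding s) t y → ⊥
  sides-disjoint {s} {t} a w w′ =
    no-bypass a (Walk-forget (Walk-mapAdj (withoutEdge-avoiding s t) w)
                 ++ʷ Walk-forget (Walk-mapAdj (withoutEdge-avoiding′ s t) (Walk-reverse w′)))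

  avoid-or-branch : ∀ {P z x t} → Walk A P z x → Avoiding t x →
                    (∃ λ s → T (A t s) × Walk A (Avoiding t) s x) ⊎ Walk A (Avoiding t) z x
  avoid-or-branch (stop _) x≢t = inj₂ (stop x≢t)
  avoid-or-branch {z = z} {t = t} (step {t = z′} _ a w) x≢t with avoid-or-branch w x≢t
  ... | inj₁ br = inj₁ br
  ... | inj₂ w′ with z ≟ t
  ...   | yes refl = inj₁ (z′ , a , w′)
  ...   | no z≢t = inj₂ (step z≢t a w′)

  branch : ∀ t x → Avoiding t x → ∃ λ s → T (A t s) × Walk A (Avoiding t) s x
  branch t x x≢t with avoid-or-branch (connected Tr t x) x≢t
  ... | inj₁ br = br
  ... | inj₂ w = ⊥-elim (Walk-start w refl)

  avoid-or-reach : ∀ {P u x} t → Walk A P u x → Walk A (λ y → P y × Avoiding t y) u x ⊎ Walk A P u t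
  avoid-or-reach {u = u} t (stop p) with u ≟ t
  ... | yes refl = inj₂ (stop p)
  ... | no u≢t = inj₁ (stop (p , u≢t))
  avoid-or-reach {u = u} t (step p a w) with u ≟ t
  ... | yes refl = inj₂ (stop p)
  ... | no u≢t with avoid-or-reach t w
  ...   | inj₁ w′ = inj₁ (step (p , u≢t) a w′)
  ...   | inj₂ w′ = inj₂ (step p a w′)

  inBranchᵇ : Fin k → Fin k → Fin k → Bool
  inBranchᵇ t s x with x ≟ t
  ... | yes _ = false
  ... | no x≢t = ⌊ proj₁ (branch t x x≢t) ≟ s ⌋

  inBranch⁺ : ∀ {t s x} → T (A t s) → Walk A (Avoiding t) s x → T (inBranchᵇ t s x)
  inBranch⁺ {t} {s} {x} a w with x ≟ t
  ... | yes x≡t = Walk-end w x≡t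
  ... | no x≢t = fromWitness (branch-unique (proj₁ (proj₂ (branch t x x≢t))) a (proj₂ (proj₂ (branch t x x≢t))) w)

  inBranch⁻ : ∀ {t s x} → T (inBranchᵇ t s x) → Walk A (Avoiding t) s x
  inBranch⁻ {t} {s} {x} h with x ≟ t
  ... | no x≢t = subst (λ z → Walk A (Avoiding t) z x) (toWitness h) (proj₂ (proj₂ (branch t x x≢t)))

  branchSize : Fin k → Fin k → ℕ
  branchSize t s = countᵇ (inBranchᵇ t s) (allFin k)

  branchSize-pos : ∀ {t s} → T (A t s) → 0 < branchSize t s
  branchSize-pos {t} {s} a = subst (_< branchSize t s) (countᵇ-const-false (allFin k))
    (countᵇ-mono-< (λ _ → false) (inBranchᵇ t s) (allFin k) (λ _ _ ()) s (∈-allFin s)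
                   (inBranch⁺ a (stop (adj⇒≢ a))) id)

  branchSize-shrinks : ∀ {t s u} → T (A t s) → T (A s u) → ¬ u ≡ t → branchSize s u < branchSize t s
  branchSize-shrinks {t} {s} {u} ats asu u≢t =
    countᵇ-mono-< (inBranchᵇ s u) (inBranchᵇ t s) (allFin k) ⊆ s (∈-allFin s)
                  (inBranch⁺ ats (stop (adj⇒≢ ats))) (λ h → Walk-end (inBranch⁻ {s} {u} h) refl)
    where
    -- A walk in the branch at s through u never meets t: else u would be the neighbour of s towards t.
    ⊆ : ∀ x → x ∈ allFin k → T (inBranchᵇ s u x) → T (inBranchᵇ t s x)
    ⊆ x _ h with avoid-or-reach t (inBranch⁻ {s} {u} {x} h)
    ... | inj₁ u⇝x = inBranch⁺ ats (step (adj⇒≢ ats) asu (Walk-map (λ _ → proj₂) u⇝x))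
    ... | inj₂ u⇝t = ⊥-elim (u≢t (branch-unique asu (adj-sym ats) u⇝t (stop (adj⇒≢ ats ∘′ ≡-sym))))

  -- Walk towards a neighbour s with 2 w t s > N; one never turns back, so the branch size strictly decreases.
  centroid : (N : ℕ) (w : Fin k → Fin k → ℕ) → (∀ t s → 0 < w t s → T (A t s)) →
             (∀ t s → T (A t s) → w t s + w s t ≤ N) → Fin k → ∃ λ t → ∀ s → 2 * w t s ≤ N
  centroid N w w⇒adj w-sides t₀ with any? (λ s → N <? 2 * w t₀ s)
  ... | no none = t₀ , λ s → ≮⇒≥ (λ heavy → none (s , heavy))
  ... | yes (s , heavy) = descend (branchSize t₀ s) t₀ s (w⇒adj t₀ s (heavy⇒pos heavy)) heavy ≤-refl
    where
    heavy⇒pos : ∀ {t s} → N < 2 * w t s → 0 < w t s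
    heavy⇒pos {t} {s} heavy with w t s
    ... | zero = ⊥-elim (<⇒≱ heavy z≤n)
    ... | suc _ = s≤s z≤n
    not-both-heavy : ∀ {t s} → T (A t s) → N < 2 * w t s → ¬ N < 2 * w s t
    not-both-heavy {t} {s} a heavy heavy′ = <⇒≱ (+-mono-< heavy heavy′) (begin
      2 * w t s + 2 * w s t ≡⟨ ≡-sym (*-distribˡ-+ 2 (w t s) (w s t)) ⟩
      2 * (w t s + w s t)   ≤⟨ *-monoʳ-≤ 2 (w-sides t s a) ⟩
      2 * N                 ≡⟨ cong (N +_) (+-identityʳ N) ⟩
      N + N                 ∎)
      where open ≤-Reasoning
    descend : ∀ m t s → T (A t s) → N < 2 * w t s → branchSize t s ≤ m → ∃ λ t → ∀ s → 2 * w t s ≤ N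
    descend zero t s a _ size≤0 = ⊥-elim (<⇒≱ (branchSize-pos a) size≤0)
    descend (suc m) t s a heavy size≤ with any? (λ u → N <? 2 * w s u)
    ... | no none = s , λ u → ≮⇒≥ (λ heavy′ → none (u , heavy′))
    ... | yes (u , heavy′) =
      descend m s u asu heavy′ (s≤s⁻¹ (≤-trans (branchSize-shrinks a asu u≢t) size≤))
      where
      asu : T (A s u)
      asu = w⇒adj s u (heavy⇒pos heavy′)
      u≢t : ¬ u ≡ t
      u≢t refl = not-both-heavy a heavy heavy′

∈-mapMaybe⁺ : ∀ {a b} {A : Set a} {B : Set b} (g : A → Maybe B) {ys : List A} {y : A} {x : B} →
              y ∈ ys → g y ≡ just x → x ∈ mapMaybe g ys
∈-mapMaybe⁺ g (here refl) gy≡x rewrite gy≡x = here refl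
∈-mapMaybe⁺ g {y′ ∷ _} (there y∈ys) gy≡x with g y′
... | nothing = ∈-mapMaybe⁺ g y∈ys gy≡x
... | just _ = there (∈-mapMaybe⁺ g y∈ys gy≡x)

Unique-⊆-mapMaybe⇒length-≤ : ∀ {a b} {A : Set a} {B : Set b} (g : A → Maybe B) (xs : List B) (ys : List A) →
                             Unique xs → (∀ x → x ∈ xs → ∃ λ y → y ∈ ys × g y ≡ just x) → length xs ≤ length ys
Unique-⊆-mapMaybe⇒length-≤ g xs ys xs! xs⊆ = ≤-trans
  (Unique-⊆⇒length-≤ xs (mapMaybe g ys) xs! λ x x∈xs → let (y , y∈ys , gy≡x) = xs⊆ x x∈xs in ∈-mapMaybe⁺ g y∈ys gy≡x)
  (length-mapMaybe g ys)

class-bound-arith : ∀ C L w N r → C * r ≤ L + w → 2 * w ≤ N * r → 10 * L < r → 10 * C ≤ 5 * N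
class-bound-arith C L w N r C*r≤ 2w≤ 10L<r = ≮⇒≥ λ 5N<10C → <⇒≱ 20C<2+10N (begin
    2 + 10 * N        ≡⟨ ≡-sym (trans (*-distribˡ-+ 2 1 (5 * N)) (cong (2 +_) (≡-sym (*-assoc 2 5 N)))) ⟩
    2 * suc (5 * N)   ≤⟨ *-monoʳ-≤ 2 5N<10C ⟩
    2 * (10 * C)      ≡⟨ ≡-sym (*-assoc 2 10 C) ⟩
    20 * C            ∎)
  where
  open ≤-Reasoning
  20C<2+10N : 20 * C < 2 + 10 * N
  20C<2+10N = *-cancelʳ-< r (20 * C) (2 + 10 * N) (begin-strict
    20 * C * r            ≡⟨ *-assoc 20 C r ⟩
    20 * (C * r)          ≤⟨ *-monoʳ-≤ 20 C*r≤ ⟩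
    20 * (L + w)          ≡⟨ *-distribˡ-+ 20 L w ⟩
    20 * L + 20 * w       ≡⟨ cong (20 * L +_) (*-assoc 10 2 w) ⟩
    20 * L + 10 * (2 * w) ≤⟨ +-monoʳ-≤ (20 * L) (*-monoʳ-≤ 10 2w≤) ⟩
    20 * L + 10 * (N * r) <⟨ +-monoˡ-< (10 * (N * r)) (subst (_< 2 * r) (≡-sym (*-assoc 2 10 L)) (*-monoʳ-< 2 10L<r)) ⟩
    2 * r + 10 * (N * r)  ≡⟨ cong (2 * r +_) (≡-sym (*-assoc 10 N r)) ⟩
    2 * r + 10 * N * r    ≡⟨ ≡-sym (*-distribʳ-+ r 2 (10 * N)) ⟩
    (2 + 10 * N) * r      ∎)

edge⇒2≤n : ∀ {n} (G : Graph n) (a b : Fin n) → T (isEdgeᵇ G (a , b)) → 2 ≤ n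
edge⇒2≤n G a b ab = ≤-trans (s≤s (≤-trans (s≤s z≤n) a<b)) (toℕ<n b)
  where
  a<b : toℕ a < toℕ b
  a<b = <ᵇ⇒< (toℕ a) (toℕ b) (proj₁ (Equivalence.to T-∧ ab))

cutSize≤numEdges : ∀ {n} (G : Graph n) (S : Subset n) → cutSize G S ≤ numEdges G
cutSize≤numEdges {n} G S = countᵇ-mono _ (isEdgeᵇ G) (allPairs n) (λ _ _ → proj₁ ∘ Equivalence.to T-∧)

balanced-exists : ∀ n → 2 ≤ n → ∃ λ (S : Subset n) → Balanced S
balanced-exists n n≥2 =
  let (j , balanced) = balanced-keyBelow (toℕ {n}) n (≤-trans (s≤s z≤n) n≥2) toℕ<n singleton-classes
  in keyBelow toℕ j , balanced
  where
  singleton-classes : ∀ j → 10 * keyClassSize (toℕ {n}) j ≤ 5 * n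
  singleton-classes j = ≤-trans (*-monoʳ-≤ 10 (countᵇ≤1 (λ v → toℕ v ≡ᵇ j) (allFin n) (allFin⁺ n) same)) (*-monoʳ-≤ 5 n≥2)
    where
    same : ∀ u v → T (toℕ u ≡ᵇ j) → T (toℕ v ≡ᵇ j) → u ≡ v
    same u v u≡j v≡j = toℕ-injective (trans (≡ᵇ⇒≡ _ j u≡j) (≡-sym (≡ᵇ⇒≡ _ j v≡j)))

≤-foldr-⊔ : ∀ {a} {A : Set a} (f : A → ℕ) {xs : List A} {x : A} → x ∈ xs → f x ≤ foldr _⊔_ 0 (map f xs)
≤-foldr-⊔ f (here refl) = m≤m⊔n (f _) _
≤-foldr-⊔ f {y ∷ _} (there x∈xs) = m≤n⇒m≤o⊔n (f y) (≤-foldr-⊔ f x∈xs)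

module Decomposition {n : ℕ} (G : Graph n) (r : ℕ) (D : TreeDecomposition (V′ G r) (E′ G r)) where

  K : ℕ
  K = suc (k D)

  open TreeBranches (tree D)

  private
    A : Fin K → Fin K → Bool
    A = tadj (tree D)

  U : Fin K → List (V′ G r)
  U = bag D

  _≟ⱽ_ : DecidableEquality (V′ G r)
  _≟ⱽ_ = Sum.≡-dec (Product.≡-dec _≟_ _≟_)
                   (Product.≡-dec (Product.≡-dec _≟_ _≟_) λ p q → yes (T-irrelevant p q))

  open Data.List.Membership.DecPropositional _≟ⱽ_ using (_∈?_)

  home : V′ G r → Fin K
  home u = proj₁ (cover D u)

  home∈ : ∀ u → u ∈ U (home u)
  home∈ u = proj₂ (cover D u)

  bags-avoiding : ∀ {t u} → ¬ u ∈ U t → ∀ x y → u ∈ U x → u ∈ U y → Walk A (Avoiding t) x y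
  bags-avoiding {t} {u} u∉Ut x y u∈Ux u∈Uy =
    Walk-map (λ z u∈Uz z≡t → u∉Ut (subst (λ z → u ∈ U z) z≡t u∈Uz)) (subtree D u x y u∈Ux u∈Uy)

  branchAt : ∀ t u → ¬ u ∈ U t → ∃ λ s → T (A t s) × Walk A (Avoiding t) s (home u)
  branchAt t u u∉Ut = branch t (home u) (λ home≡t → u∉Ut (subst (λ z → u ∈ U z) home≡t (home∈ u)))

  branchOf : ∀ t u → ¬ u ∈ U t → Fin K
  branchOf t u u∉Ut = proj₁ (branchAt t u u∉Ut)

  branchOf-adj : ∀ t u u∉Ut → T (A t (branchOf t u u∉Ut))
  branchOf-adj t u u∉Ut = proj₁ (proj₂ (branchAt t u u∉Ut))

  branchOf-reaches : ∀ t u u∉Ut y → u ∈ U y → Walk A (Avoiding t) (branchOf t u u∉Ut) y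
  branchOf-reaches t u u∉Ut y u∈Uy = proj₂ (proj₂ (branchAt t u u∉Ut)) ++ʷ bags-avoiding u∉Ut (home u) y (home∈ u) u∈Uy

  branchOf-shared : ∀ t u₁ u₂ u₁∉Ut u₂∉Ut y → u₁ ∈ U y → u₂ ∈ U y → branchOf t u₁ u₁∉Ut ≡ branchOf t u₂ u₂∉Ut
  branchOf-shared t u₁ u₂ u₁∉Ut u₂∉Ut y u₁∈Uy u₂∈Uy =
    branch-unique (branchOf-adj t u₁ u₁∉Ut) (branchOf-adj t u₂ u₂∉Ut)
                  (branchOf-reaches t u₁ u₁∉Ut y u₁∈Uy) (branchOf-reaches t u₂ u₂∉Ut y u₂∈Uy)

  branchOf-irrelevant : ∀ t u u∉Ut u∉Ut′ → branchOf t u u∉Ut ≡ branchOf t u u∉Ut′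
  branchOf-irrelevant t u u∉Ut u∉Ut′ = branchOf-shared t u u u∉Ut u∉Ut′ (home u) (home∈ u) (home∈ u)

  copies : List (Fin n × Fin r)
  copies = cartesianProduct (allFin n) (allFin r)

  length-copies : length copies ≡ n * r
  length-copies = begin
    length copies                                   ≡⟨ ≡-sym (countᵇ-const-true copies) ⟩
    countᵇ (λ _ → true) copies                      ≡⟨ countᵇ-cartesianProduct (λ _ → true) (allFin n) (allFin r) ⟩
    countᵇ (λ _ → true) (allFin n) * length (allFin r)
                                                    ≡⟨ cong₂ _*_ (countᵇ-const-true (allFin n)) refl ⟩
    length (allFin n) * length (allFin r)           ≡⟨ cong₂ _*_ (length-tabulate {n = n} id) (length-tabulate {n = r} id) ⟩
    n * r                                           ∎
    where open ≡-Reasoning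

  copyInBranchᵇ : Fin K → Fin K → Fin n × Fin r → Bool
  copyInBranchᵇ t s c with inj₁ c ∈? U t
  ... | yes _ = false
  ... | no c∉Ut = ⌊ branchOf t (inj₁ c) c∉Ut ≟ s ⌋

  copyInBranch⁻ : ∀ t s c → T (copyInBranchᵇ t s c) → Σ (¬ inj₁ c ∈ U t) λ c∉Ut → branchOf t (inj₁ c) c∉Ut ≡ s
  copyInBranch⁻ t s c h with inj₁ c ∈? U t
  ... | no c∉Ut = c∉Ut , toWitness h

  copyInBranch⁺ : ∀ t s c c∉Ut → branchOf t (inj₁ c) c∉Ut ≡ s → T (copyInBranchᵇ t s c)
  copyInBranch⁺ t s c c∉Ut branch≡s with inj₁ c ∈? U t
  ... | yes c∈Ut = c∉Ut c∈Ut
  ... | no c∉Ut′ = fromWitness (trans (branchOf-irrelevant t (inj₁ c) c∉Ut′ c∉Ut) branch≡s)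

  copyWeight : Fin K → Fin K → ℕ
  copyWeight t s = countᵇ (copyInBranchᵇ t s) copies

  copyWeight-sides : ∀ t s → T (A t s) → copyWeight t s + copyWeight s t ≤ n * r
  copyWeight-sides t s a = subst (copyWeight t s + copyWeight s t ≤_) length-copies
    (countᵇ-disjoint (copyInBranchᵇ t s) (copyInBranchᵇ s t) copies disjoint)
    where
    disjoint : ∀ c → T (copyInBranchᵇ t s c) → T (copyInBranchᵇ s t c) → ⊥
    disjoint c h h′ with copyInBranch⁻ t s c h | copyInBranch⁻ s t c h′
    ... | c∉Ut , branch≡s | c∉Us , branch≡t =
      sides-disjoint (adj-sym a) (reaches-home t s c∉Ut branch≡s) (reaches-home s t c∉Us branch≡t)
      where
      reaches-home : ∀ t s c∉Ut → branchOf t (inj₁ c) c∉Ut ≡ s → Walk A (Avoiding t) s (home (inj₁ c))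
      reaches-home t s c∉Ut branch≡s = subst (λ z → Walk A (Avoiding t) z (home (inj₁ c))) branch≡s
        (branchOf-reaches t (inj₁ c) c∉Ut (home (inj₁ c)) (home∈ (inj₁ c)))

  copyWeight⇒adj : ∀ t s → 0 < copyWeight t s → T (A t s)
  copyWeight⇒adj t s pos with countᵇ>0⇒∃ (copyInBranchᵇ t s) copies pos
  ... | c , _ , h with copyInBranch⁻ t s c h
  ...   | c∉Ut , branch≡s = subst (λ z → T (A t z)) branch≡s (branchOf-adj t (inj₁ c) c∉Ut)

  centralBag : ∃ λ t → ∀ s → 2 * copyWeight t s ≤ n * r
  centralBag = centroid (n * r) copyWeight copyWeight⇒adj copyWeight-sides Fin.zero

  copyOf : V′ G r → Maybe (Fin n × Fin r)
  copyOf (inj₁ c) = just c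
  copyOf (inj₂ _) = nothing

  edgePairOf : V′ G r → Maybe (Fin n × Fin n)
  edgePairOf (inj₁ _) = nothing
  edgePairOf (inj₂ (p , _)) = just p

  module CentralBag (t : Fin K) (central : ∀ s → 2 * copyWeight t s ≤ n * r)
                    (bag-small : 10 * length (U t) < r) (n≥2 : 2 ≤ n) where

    Incident : Fin n → Edge G → Set
    Incident v e = _∈ₑ_ {G = G} v e

    incident? : ∀ v e → Dec (Incident v e)
    incident? v ((a , b) , _) with v ≟ a | v ≟ b
    ... | yes v≡a | _ = yes (inj₁ v≡a)
    ... | no _ | yes v≡b = yes (inj₂ v≡b)
    ... | no v≢a | no v≢b = no λ { (inj₁ v≡a) → v≢a v≡a ; (inj₂ v≡b) → v≢b v≡b }

    OutsideEdgeAt : Fin n → Fin n × Fin n → Set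
    OutsideEdgeAt v p = Σ (T (isEdgeᵇ G p)) λ e → Incident v (p , e) × ¬ inj₂ (p , e) ∈ U t

    outsideEdgeAt? : ∀ v p → Dec (OutsideEdgeAt v p)
    outsideEdgeAt? v p with T? (isEdgeᵇ G p)
    ... | no ¬e = no (¬e ∘ proj₁)
    ... | yes e with incident? v (p , e) | inj₂ (p , e) ∈? U t
    ...   | yes v∈e | no e∉Ut = yes (e , v∈e , e∉Ut)
    ...   | no v∉e | _ = no λ (e′ , v∈e , _) → v∉e (subst (λ e → Incident v (p , e)) (T-irrelevant e′ e) v∈e)
    ...   | _ | yes e∈Ut = no λ (e′ , _ , e∉Ut) → e∉Ut (subst (λ e → inj₂ (p , e) ∈ U t) (T-irrelevant e e′) e∈Ut)

    -- A vertex with an incident edge outside U t lives, outside U t, in the single branch of that edge;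
    -- the remaining vertices get pairwise distinct keys beyond all branches.
    key : Fin n → ℕ
    key v with any? (λ a → any? (λ b → outsideEdgeAt? v (a , b)))
    ... | yes (a , b , e , _ , e∉Ut) = toℕ (branchOf t (inj₂ ((a , b) , e)) e∉Ut)
    ... | no _ = K + toℕ v

    key-cases : ∀ v → (∃ λ e → Incident v e × Σ (¬ inj₂ e ∈ U t) λ e∉Ut → key v ≡ toℕ (branchOf t (inj₂ e) e∉Ut))
                      ⊎ ((∀ e → Incident v e → inj₂ e ∈ U t) × key v ≡ K + toℕ v)
    key-cases v with any? (λ a → any? (λ b → outsideEdgeAt? v (a , b)))
    ... | yes (a , b , e , v∈e , e∉Ut) = inj₁ (((a , b) , e) , v∈e , e∉Ut , refl)
    ... | no none = inj₂ (inside , refl)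
      where
      inside : ∀ e → Incident v e → inj₂ e ∈ U t
      inside ((a , b) , e) v∈e with inj₂ ((a , b) , e) ∈? U t
      ... | yes e∈Ut = e∈Ut
      ... | no e∉Ut = ⊥-elim (none (a , b , e , v∈e , e∉Ut))

    copyOutside : ∀ v → ∃ λ i → ¬ inj₁ (v , i) ∈ U t
    copyOutside v with any? (λ i → ¬? (inj₁ (v , i) ∈? U t))
    ... | yes outside = outside
    ... | no none = ⊥-elim (<⇒≱ bag-small (begin
        r                              ≡⟨ ≡-sym (trans (length-map (v ,_) (allFin r)) (length-tabulate id)) ⟩
        length (map (v ,_) (allFin r)) ≤⟨ Unique-⊆-mapMaybe⇒length-≤ copyOf _ (U t) (map⁺ (cong proj₂) (allFin⁺ r)) all-inside ⟩
        length (U t)                   ≤⟨ m≤n*m (length (U t)) 10 ⟩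
        10 * length (U t)              ∎))
      where
      open ≤-Reasoning
      inside : ∀ i → inj₁ (v , i) ∈ U t
      inside i with inj₁ (v , i) ∈? U t
      ... | yes c∈Ut = c∈Ut
      ... | no c∉Ut = ⊥-elim (none (i , c∉Ut))
      all-inside : ∀ c → c ∈ map (v ,_) (allFin r) → ∃ λ u → u ∈ U t × copyOf u ≡ just c
      all-inside c c∈ with ∈-map⁻ (v ,_) c∈
      ... | i , _ , refl = inj₁ (v , i) , inside i , refl

    edge-copy-branch : ∀ v e → Incident v e → (e∉Ut : ¬ inj₂ e ∈ U t) → ∀ i (c∉Ut : ¬ inj₁ (v , i) ∈ U t) →
                       branchOf t (inj₂ e) e∉Ut ≡ branchOf t (inj₁ (v , i)) c∉Ut
    edge-copy-branch v e v∈e e∉Ut i c∉Ut with edgeCov D (inj₂ e) (inj₁ (v , i)) (e-v e v i v∈e)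
    ... | y , e∈Uy , c∈Uy = branchOf-shared t _ _ e∉Ut c∉Ut y e∈Uy c∈Uy

    key-edge : ∀ v e → Incident v e → (e∉Ut : ¬ inj₂ e ∈ U t) → key v ≡ toℕ (branchOf t (inj₂ e) e∉Ut)
    key-edge v e v∈e e∉Ut with key-cases v | copyOutside v
    ... | inj₂ (inside , _) | _ = ⊥-elim (e∉Ut (inside e v∈e))
    ... | inj₁ (e′ , v∈e′ , e′∉Ut , key≡) | i , c∉Ut = trans key≡ (cong toℕ
          (trans (edge-copy-branch v e′ v∈e′ e′∉Ut i c∉Ut) (≡-sym (edge-copy-branch v e v∈e e∉Ut i c∉Ut))))

    key< : ∀ v → key v < K + n
    key< v with key-cases v
    ... | inj₁ (e , _ , e∉Ut , key≡) = subst (_< K + n) (≡-sym key≡) (≤-trans (toℕ<n (branchOf t (inj₂ e) e∉Ut)) (m≤m+n K n))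
    ... | inj₂ (_ , key≡) = subst (_< K + n) (≡-sym key≡) (+-monoʳ-< K (toℕ<n v))

    cut≤bag : ∀ j → cutSize G (keyBelow key j) ≤ length (U t)
    cut≤bag j = Unique-⊆-mapMaybe⇒length-≤ edgePairOf _ (U t)
                  (Unique-filterᵇ _ (cartesianProduct⁺ (allFin⁺ n) (allFin⁺ n))) crossing-inside
      where
      crossing-inside : ∀ p → p ∈ filterᵇ _ (allPairs n) → ∃ λ u → u ∈ U t × edgePairOf u ≡ just p
      crossing-inside p p∈ with Equivalence.to T-∧ (proj₂ (∈-filterᵇ⁻ _ (allPairs n) p∈))
      ... | e , crossing with inj₂ (p , e) ∈? U t
      ...   | yes p∈Ut = inj₂ (p , e) , p∈Ut , refl
      ...   | no p∉Ut = ⊥-elim (keyBelow-separates key j (proj₁ p) (proj₂ p) crossing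
              (trans (key-edge (proj₁ p) (p , e) (inj₁ refl) p∉Ut) (≡-sym (key-edge (proj₂ p) (p , e) (inj₂ refl) p∉Ut))))

    inUᵇ : Fin n × Fin r → Bool
    inUᵇ c = does (inj₁ c ∈? U t)

    copiesInU≤bag : countᵇ inUᵇ copies ≤ length (U t)
    copiesInU≤bag = Unique-⊆-mapMaybe⇒length-≤ copyOf _ (U t)
                      (Unique-filterᵇ inUᵇ (cartesianProduct⁺ (allFin⁺ n) (allFin⁺ r))) inside
      where
      inside : ∀ c → c ∈ filterᵇ inUᵇ copies → ∃ λ u → u ∈ U t × copyOf u ≡ just c
      inside c c∈ with inj₁ c ∈? U t | proj₂ (∈-filterᵇ⁻ inUᵇ copies c∈)
      ... | yes c∈Ut | _ = inj₁ c , c∈Ut , refl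

    -- All r copies of a vertex in the class of branch b lie in U t or in b: few in U t, at most nr/2 in b.
    class≤n/2 : ∀ j → 10 * keyClassSize key j ≤ 5 * n
    class≤n/2 j with j <? K
    ... | yes j<K = class-bound-arith (keyClassSize key j) (length (U t)) (copyWeight t b) n r copies≤ (central b) bag-small
      where
      b : Fin K
      b = fromℕ< j<K
      inside-or-branch : ∀ c → c ∈ copies → T (key (proj₁ c) ≡ᵇ j) → T (inUᵇ c) ⊎ T (copyInBranchᵇ t b c)
      inside-or-branch (v , i) _ key≡j = by-membership (inj₁ (v , i) ∈? U t)
        where
        by-membership : (c∈? : Dec (inj₁ (v , i) ∈ U t)) → T (does c∈?) ⊎ T (copyInBranchᵇ t b (v , i))
        by-membership (yes _) = inj₁ tt
        by-membership (no c∉Ut) with key-cases v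
        ... | inj₂ (_ , key≡) =
              ⊥-elim (<⇒≱ j<K (subst (K ≤_) (trans (≡-sym key≡) (≡ᵇ⇒≡ _ j key≡j)) (m≤m+n K (toℕ v))))
        ... | inj₁ (e , v∈e , e∉Ut , key≡) = inj₂ (copyInBranch⁺ t b (v , i) c∉Ut
              (trans (≡-sym (edge-copy-branch v e v∈e e∉Ut i c∉Ut))
                     (toℕ-injective (trans (≡-sym key≡) (trans (≡ᵇ⇒≡ _ j key≡j) (≡-sym (toℕ-fromℕ< j<K)))))))
      copies≤ : keyClassSize key j * r ≤ length (U t) + copyWeight t b
      copies≤ = begin
        keyClassSize key j * r                   ≡⟨ cong (keyClassSize key j *_) (≡-sym (length-tabulate {n = r} id)) ⟩
        keyClassSize key j * length (allFin r)   ≡⟨ ≡-sym (countᵇ-cartesianProduct (λ v → key v ≡ᵇ j) (allFin n) (allFin r)) ⟩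
        countᵇ (λ c → key (proj₁ c) ≡ᵇ j) copies ≤⟨ countᵇ-≤-+ (λ c → key (proj₁ c) ≡ᵇ j) inUᵇ (copyInBranchᵇ t b) copies inside-or-branch ⟩
        countᵇ inUᵇ copies + copyWeight t b      ≤⟨ +-monoˡ-≤ (copyWeight t b) copiesInU≤bag ⟩
        length (U t) + copyWeight t b            ∎
        where open ≤-Reasoning
    ... | no j≮K = ≤-trans (*-monoʳ-≤ 10 (countᵇ≤1 (λ v → key v ≡ᵇ j) (allFin n) (allFin⁺ n) same)) (*-monoʳ-≤ 5 n≥2)
      where
      free : ∀ v → T (key v ≡ᵇ j) → K + toℕ v ≡ j
      free v key≡j with key-cases v
      ... | inj₂ (_ , key≡) = trans (≡-sym key≡) (≡ᵇ⇒≡ _ j key≡j)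
      ... | inj₁ (e , _ , e∉Ut , key≡) =
            ⊥-elim (j≮K (subst (_< K) (trans (≡-sym key≡) (≡ᵇ⇒≡ _ j key≡j)) (toℕ<n (branchOf t (inj₂ e) e∉Ut))))
      same : ∀ u v → T (key u ≡ᵇ j) → T (key v ≡ᵇ j) → u ≡ v
      same u v key-u≡j key-v≡j = toℕ-injective (+-cancelˡ-≡ K _ _ (trans (free u key-u≡j) (≡-sym (free v key-v≡j))))

    balanced-cut≤bag : ∃ λ S → Balanced S × cutSize G S ≤ length (U t)
    balanced-cut≤bag =
      let (j , balanced) = balanced-keyBelow key (K + n) (≤-trans (s≤s z≤n) n≥2) key< class≤n/2
      in keyBelow key j , balanced , cut≤bag j

  bag-length≤ : ∀ t → length (U t) ≤ suc (width D)
  bag-length≤ t = ≤-trans (≤-foldr-⊔ (length ∘ U) (∈-allFin t)) (m≤n+m∸n _ 1)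

  width-pos : ∀ {a b} (e : T (isEdgeᵇ G (a , b))) → Fin r → 1 ≤ width D
  width-pos {a} {b} e i with edgeCov D (inj₂ ((a , b) , e)) (inj₁ (a , i)) (e-v ((a , b) , e) a i (inj₁ refl))
  ... | y , e∈Uy , c∈Uy = s≤s⁻¹ (≤-trans two≤ (bag-length≤ y))
    where
    two≤ : 2 ≤ length (U y)
    two≤ = Unique-⊆⇒length-≤ (inj₂ ((a , b) , e) ∷ inj₁ (a , i) ∷ []) (U y) (((λ ()) ∷ []) ∷ [] ∷ [])
             λ { _ (here refl) → e∈Uy ; _ (there (here refl)) → c∈Uy }

  balanced-narrow-cut : n * numEdges G ≤ r → 1 ≤ numEdges G →
                        1 ≤ width D × ∃ λ S → Balanced S × cutSize G S ≤ 5 * suc (width D)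
  balanced-narrow-cut nM≤r M≥1 with countᵇ>0⇒∃ (isEdgeᵇ G) (allPairs n) M≥1
  ... | (a , b) , _ , e = width-pos e (fromℕ< r≥1) , narrow-cut (10 * suc (width D) <? r)
    where
    n≥2 : 2 ≤ n
    n≥2 = edge⇒2≤n G a b e
    r≥1 : 1 ≤ r
    r≥1 = ≤-trans (≤-trans (s≤s z≤n) n≥2) (≤-trans (m≤m*n n (numEdges G)) nM≤r)
      where instance _ = >-nonZero M≥1
    narrow-cut : Dec (10 * suc (width D) < r) → ∃ λ S → Balanced S × cutSize G S ≤ 5 * suc (width D)
    narrow-cut (yes bags-small) =
      let (t , central) = centralBag
          (S , balanced , cut≤) = CentralBag.balanced-cut≤bag t central
                                    (≤-<-trans (*-monoʳ-≤ 10 (bag-length≤ t)) bags-small) n≥2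
      in S , balanced , ≤-trans cut≤ (≤-trans (bag-length≤ t) (m≤n*m (suc (width D)) 5))
    narrow-cut (no bags-large) =
      let (S , balanced) = balanced-exists n n≥2
      in S , balanced , ≤-trans (cutSize≤numEdges G S) (*-cancelˡ-≤ 2 (begin
           2 * numEdges G         ≤⟨ *-monoˡ-≤ (numEdges G) n≥2 ⟩
           n * numEdges G         ≤⟨ nM≤r ⟩
           r                      ≤⟨ ≮⇒≥ bags-large ⟩
           10 * suc (width D)     ≡⟨ *-assoc 2 5 (suc (width D)) ⟩
           2 * (5 * suc (width D)) ∎))
      where open ≤-Reasoning

ℕ→ℚ≡mkℚ : ∀ a → ℕ→ℚ a ≡ ℚ.mkℚ (ℤ.+ a) 0 (Coprime.sym (1-coprimeTo a))
ℕ→ℚ≡mkℚ a = ℚ.normalize-coprime (Coprime.sym (1-coprimeTo a))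

ℕ→ℚ-* : ∀ a b → ℕ→ℚ (a * b) ≡ ℕ→ℚ a ℚ.* ℕ→ℚ b
ℕ→ℚ-* a b rewrite ℕ→ℚ≡mkℚ a | ℕ→ℚ≡mkℚ b = cong (ℚ._/ 1) (ℤ.pos-* a b)

ℕ→ℚ-mono : ∀ {a b} → a ≤ b → ℕ→ℚ a ℚ.≤ ℕ→ℚ b
ℕ→ℚ-mono {a} {b} a≤b rewrite ℕ→ℚ≡mkℚ a | ℕ→ℚ≡mkℚ b =
  ℚ.*≤* (subst₂ ℤ._≤_ (≡-sym (ℤ.*-identityʳ (ℤ.+ a))) (≡-sym (ℤ.*-identityʳ (ℤ.+ b))) (ℤ.+≤+ a≤b))

ℕ→ℚ-nonNeg : ∀ a → ℚ.NonNegative (ℕ→ℚ a)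
ℕ→ℚ-nonNeg a = ℚ.normalize-nonNeg a 1

sqℚ-mono : ∀ {a b} → a ≤ b → sqℚ a ℚ.≤ sqℚ b
sqℚ-mono {a} {b} a≤b = ℚ.≤-trans (ℚ.*-monoˡ-≤-nonNeg (ℕ→ℚ a) {{ℕ→ℚ-nonNeg a}} (ℕ→ℚ-mono a≤b))
                                  (ℚ.*-monoʳ-≤-nonNeg (ℕ→ℚ b) {{ℕ→ℚ-nonNeg b}} (ℕ→ℚ-mono a≤b))

tenth : ℚ
tenth = ℤ.+ 1 ℚ./ 10

shrink-by-tenth : (c ε : ℚ) (m x w : ℕ) → c *ℚ c *ℚ ε *ℚ sqℚ m ≤ℚ sqℚ x → x ≤ 10 * w →
                  (c *ℚ tenth) *ℚ (c *ℚ tenth) *ℚ ε *ℚ sqℚ m ≤ℚ sqℚ w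
shrink-by-tenth c ε m x w bound x≤10w = begin
    c *ℚ tenth *ℚ (c *ℚ tenth) *ℚ ε *ℚ sqℚ m
  ≡⟨ solve 4 (λ c t ε m → c :* t :* (c :* t) :* ε :* m := c :* c :* ε :* m :* (t :* t)) refl c tenth ε (sqℚ m) ⟩
    c *ℚ c *ℚ ε *ℚ sqℚ m *ℚ (tenth *ℚ tenth)
  ≤⟨ ℚ.*-monoʳ-≤-nonNeg (tenth *ℚ tenth) (ℚ.≤-trans bound (sqℚ-mono x≤10w)) ⟩
    sqℚ (10 * w) *ℚ (tenth *ℚ tenth)
  ≡⟨ cong (_*ℚ (tenth *ℚ tenth)) (cong₂ _*ℚ_ (ℕ→ℚ-* 10 w) (ℕ→ℚ-* 10 w)) ⟩
    ℕ→ℚ 10 *ℚ ℕ→ℚ w *ℚ (ℕ→ℚ 10 *ℚ ℕ→ℚ w) *ℚ (tenth *ℚ tenth)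
  ≡⟨ solve 3 (λ a v t → a :* v :* (a :* v) :* (t :* t) := v :* v :* (a :* t :* (a :* t))) refl (ℕ→ℚ 10) (ℕ→ℚ w) tenth ⟩
    sqℚ w *ℚ (ℕ→ℚ 10 *ℚ tenth *ℚ (ℕ→ℚ 10 *ℚ tenth))
  ≡⟨ ℚ.*-identityʳ (sqℚ w) ⟩
    sqℚ w ∎
  where
  open ℚ.≤-Reasoning
  open +-*-Solver

5[1+w]≤10w : ∀ w → 1 ≤ w → 5 * suc w ≤ 10 * w
5[1+w]≤10w w w≥1 = begin
  5 * suc w   ≡⟨ *-suc 5 w ⟩
  5 + 5 * w   ≤⟨ +-monoˡ-≤ (5 * w) (*-monoʳ-≤ 5 w≥1) ⟩
  5 * w + 5 * w ≡⟨ ≡-sym (*-distribʳ-+ w 5 5) ⟩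
  10 * w      ∎
  where open ≤-Reasoning

width-lower-bound : (c : ℚ) (n : ℕ) (G : Graph n) (ε : ℚ) →
                    ((S : Subset n) → n ≤ 10 * ∣ S ∣ → 10 * ∣ S ∣ ≤ 9 * n →
                      c *ℚ c *ℚ ε *ℚ sqℚ (numEdges G) ≤ℚ sqℚ (cutSize G S)) →
                    (r : ℕ) → n * numEdges G ≤ r → (D : TreeDecomposition (V′ G r) (E′ G r)) →
                    (c *ℚ tenth) *ℚ (c *ℚ tenth) *ℚ ε *ℚ sqℚ (numEdges G) ≤ℚ sqℚ (width D)
width-lower-bound c n G ε expansion r nM≤r D = by-edges (1 ≤? numEdges G)
  where
  by-edges : Dec (1 ≤ numEdges G) → (c *ℚ tenth) *ℚ (c *ℚ tenth) *ℚ ε *ℚ sqℚ (numEdges G) ≤ℚ sqℚ (width D)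
  by-edges (no M≱1) = subst (λ m → (c *ℚ tenth) *ℚ (c *ℚ tenth) *ℚ ε *ℚ sqℚ m ≤ℚ sqℚ (width D))
    (≡-sym (n<1⇒n≡0 (≰⇒> M≱1)))
    (subst (_≤ℚ sqℚ (width D)) (≡-sym (ℚ.*-zeroʳ ((c *ℚ tenth) *ℚ (c *ℚ tenth) *ℚ ε))) (sqℚ-mono {0} {width D} z≤n))
  by-edges (yes M≥1) =
    let (w≥1 , S , (n≤10S , 10S≤9n) , cut≤) = Decomposition.balanced-narrow-cut G r D nM≤r M≥1
    in shrink-by-tenth c ε (numEdges G) (cutSize G S) (width D) (expansion S n≤10S 10S≤9n)
                       (≤-trans cut≤ (5[1+w]≤10w (width D) w≥1))

lemma5p1 : (c : ℚ) → 0ℚ <ℚ c →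
    Σ ℚ λ c′ → (0ℚ <ℚ c′) ×
      ((n : ℕ) (G : Graph n) (ε : ℚ) → 0ℚ <ℚ ε →
        ((S : Subset n) → n ≤ 10 * ∣ S ∣ → 10 * ∣ S ∣ ≤ 9 * n →
          c *ℚ c *ℚ ε *ℚ sqℚ (numEdges G) ≤ℚ sqℚ (cutSize G S)) →
        (r : ℕ) → n * numEdges G ≤ r →
        (D : TreeDecomposition (V′ G r) (E′ G r)) →
          c′ *ℚ c′ *ℚ ε *ℚ sqℚ (numEdges G) ≤ℚ sqℚ (width D))
lemma5p1 c c>0 =
  c *ℚ tenth , ℚ.positive⁻¹ _ {{ℚ.pos*pos⇒pos c {{ℚ.positive c>0}} tenth}} ,
  λ n G ε _ → width-lower-bound c n G ε
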